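{- For all $n\in\mathbb{N}$ with $n\ge1$ and all $X\in\mathrm{IS}$ of the form $\mathtt{out}.\mathtt{set}{:}1;Y$ or $+\mathtt{out}.\mathtt{set}{:}1;Y$ (with $Y\in\mathrm{IS}$): if $X$ computes $\mathrm{tstnz}_n$, then $\mathrm{len}(X)>L(n)$.
   Context: Basic instructions: $\mathtt{in}{:}i.\mathtt{get}$ ($i\ge1$), $\mathtt{out}.\mathtt{set}{:}b$ ($b\in\{0,1\}$), $\mathtt{aux}{:}i.\mathtt{get}$ ($i\ge1$), $\mathtt{aux}{:}i.\mathtt{set}{:}b$ ($i\ge1$, $b\in\{0,1\}$). The part before the dot names a Boolean register ($\mathtt{in}{:}i$ input, $\mathtt{out}$ output, $\mathtt{aux}{:}i$ auxiliary); $\mathtt{get}$ changes nothing and replies the content, $\mathtt{set}{:}b$ makes the content $b$ and replies $b$. Primitive instructions: for each basic instruction $a$, plain $a$, positive test $+a$, negative test $-a$; forward jumps $\#l$ ($l\in\mathbb{N}$); termination $!$. $\mathrm{IS}$ is the set of finite sequences $X=u_1;\dots;u_k$ of primitive instructions, $\mathrm{len}(X)=k$. Execution starts at $u_1$: plain $a$ executes $a$ and proceeds with the next instruction; $+a$ executes $a$ and proceeds with the next instruction if the reply is $1$, otherwise skips the next one and proceeds with the one after it; $-a$ likewise with replies reversed; $\#l$ proceeds with the $l$-th next instruction; $!$ terminates. If $l=0$ or there is no instruction to proceed with, execution never terminates. For $f:\{0,1\}^n\to\{0,1\}$, $X$ computes $f$ if there is $k$ such that for all $b_1,\dots,b_n$,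 executing $X$ with $\mathtt{in}{:}i$ initially $b_i$, $\mathtt{out}$ and $\mathtt{aux}{:}1,\dots,\mathtt{aux}{:}k$ initially $0$ (other registers arbitrary) terminates with final content of $\mathtt{out}$ equal to $f(b_1,\dots,b_n)$. $\mathrm{tstnz}_n(b_1,\dots,b_n)=1$ iff some $b_i=1$. $L(n)=3n/2+1$ for even $n$, $3(n+1)/2$ for odd $n$. -}

module Defs where

open import Data.Bool using (Bool; true; false; _∨_; if_then_else_)
open import Data.Nat using (ℕ; zero; suc; _+_; _*_; _<_; _≤_; _≟_; NonZero)
open import Data.Nat.DivMod using (_/_)
open import Data.Fin using (Fin; fromℕ<)
open import Data.Vec using (Vec; []; _∷_; lookup)
open import Data.List using (List; []; _∷_; length)
open import Data.Maybe using (Maybe; just; nothing)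
open import Data.Product using (Σ; _×_; _,_; ∃; proj₁; proj₂)
open import Relation.Binary.PropositionalEquality using (_≡_)
open import Relation.Nullary using (yes; no)

data Basic : Set where
  in-get  : (i : ℕ) → .{{NonZero i}} → Basic
  out-set : Bool → Basic
  aux-get : (i : ℕ) → .{{NonZero i}} → Basic
  aux-set : (i : ℕ) → .{{NonZero i}} → Bool → Basic

data Instr : Set where
  plain : Basic → Instr
  ptest : Basic → Instr
  ntest : Basic → Instr
  jump  : ℕ → Instr
  halt  : Instr

IS : Set
IS = List Instr

lookup-pos : IS → ℕ → Maybe Instr
lookup-pos []      _       = nothing
lookup-pos (u ∷ X) zero    = just u
lookup-pos (u ∷ X) (suc p) = lookup-pos X p

-- Register state: in:i, out, aux:i (index 0 of inR/auxR is irrelevant).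
record State : Set where
  constructor st
  field
    inR  : ℕ → Bool
    outR : Bool
    auxR : ℕ → Bool
open State

update : (ℕ → Bool) → ℕ → Bool → ℕ → Bool
update f i b j with i ≟ j
... | yes _ = b
... | no _  = f j

execB : Basic → State → Bool × State
execB (in-get i)    σ = inR σ i , σ
execB (out-set b)   σ = b , st (inR σ) b (auxR σ)
execB (aux-get i)   σ = auxR σ i , σ
execB (aux-set i b) σ = b , st (inR σ) (outR σ) (update (auxR σ) i b)

-- No rule for #0 and for falling off the sequence: these never terminate.
data Runs (X : IS) : ℕ → State → State → Set where
  r-plain : ∀ {p a σ σ'} → lookup-pos X p ≡ just (plain a) →
            Runs X (suc p) (proj₂ (execB a σ)) σ' → Runs X p σ σ'
  r-ptest-1 : ∀ {p a σ σ'} → lookup-pos X p ≡ just (ptest a) →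
            proj₁ (execB a σ) ≡ true →
            Runs X (suc p) (proj₂ (execB a σ)) σ' → Runs X p σ σ'
  r-ptest-0 : ∀ {p a σ σ'} → lookup-pos X p ≡ just (ptest a) →
            proj₁ (execB a σ) ≡ false →
            Runs X (suc (suc p)) (proj₂ (execB a σ)) σ' → Runs X p σ σ'
  r-ntest-0 : ∀ {p a σ σ'} → lookup-pos X p ≡ just (ntest a) →
            proj₁ (execB a σ) ≡ false →
            Runs X (suc p) (proj₂ (execB a σ)) σ' → Runs X p σ σ'
  r-ntest-1 : ∀ {p a σ σ'} → lookup-pos X p ≡ just (ntest a) →
            proj₁ (execB a σ) ≡ true →
            Runs X (suc (suc p)) (proj₂ (execB a σ)) σ' → Runs X p σ σ'
  r-jump  : ∀ {p l σ σ'} → lookup-pos X p ≡ just (jump (suc l)) →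
            Runs X (p + suc l) σ σ' → Runs X p σ σ'
  r-halt  : ∀ {p σ} → lookup-pos X p ≡ just halt → Runs X p σ σ

Computes : (n : ℕ) → (Vec Bool n → Bool) → IS → Set
Computes n f X =
  ∃ λ (k : ℕ) → ∀ (b : Vec Bool n) (σ : State) →
    (∀ i (i<n : i < n) → inR σ (suc i) ≡ lookup b (fromℕ< i<n)) →
    outR σ ≡ false →
    (∀ i → 1 ≤ i → i ≤ k → auxR σ i ≡ false) →
    ∃ λ σ' → Runs X 0 σ σ' × outR σ' ≡ f b

tstnz : (n : ℕ) → Vec Bool n → Bool
tstnz zero    []       = false
tstnz (suc n) (x ∷ xs) = x ∨ tstnz n xs

even : ℕ → Bool
even zero          = true
even (suc zero)    = false
even (suc (suc n)) = even n

L : ℕ → ℕ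
L n = if even n then (3 * n) / 2 + 1 else (3 * (n + 1)) / 2

module Submission where

-- Run X on the all-zero input; it accepts 0, so besides the initial out.set:1 and a
-- halting instruction it visits an out.set:0.  The run on the i-th unit vector returns 1,
-- so the two runs must part somewhere, and they can only do so at a test of in:i visited
-- by the zero run.  There the zero run takes the branch for 0, which leaves a trace next
-- to the test: a skipped instruction at s+1 or s+2, or an assignment at s+1.  (If s+1 is
-- executed only by the zero run and changes no register, both runs meet again at s+2 in
-- agreeing states, and a later test of in:i is found.)  Split every position into two
-- half-slots: the start, the halt and each test fill both halves of their position, the
-- reset fills the first, and the trace of test s fills the first half of a skipped s+1,
-- the second half of a skipped s+2 or the second half of an assignment at s+1.  These
-- 5 + 3n half-slots are pairwise distinct, so 2 len(X) ≥ 3n + 5 > 2 L(n).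

open import Defs
open import Data.Bool using (Bool; true; false; not; if_then_else_)
open import Data.Fin as Fin using (Fin; toℕ; fromℕ<; combine; inject₁)
open import Data.Fin.Patterns using (0F; 1F; 2F; 3F; 4F)
open import Data.Fin.Properties
  using (toℕ-fromℕ<; toℕ-injective; combine-injective; injective⇒≤; +↔⊎; *↔×)
open import Data.Nat using (ℕ; zero; suc; _+_; _*_; _/_; _≤_; _<_; _≟_; s≤s; z<s; NonZero)
open import Data.Nat.DivMod using (m/n*n≤m)
open import Data.Nat.Properties
open import Data.List using (List; []; _∷_; length)
open import Data.List.Membership.Propositional using (_∈_; _∉_)
open import Data.List.Membership.DecPropositional _≟_ using (_∈?_)
open import Data.List.Relation.Unary.Any using (here; there)
open import Data.Maybe using (Maybe; just; nothing)
open import Data.Product using (∃; _×_; _,_; proj₁; proj₂)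
open import Data.Product.Properties using (,-injective; ×-≡,≡→≡)
open import Data.Sum using (_⊎_; inj₁; inj₂)
open import Data.Sum.Function.Propositional using (_⊎-↔_)
open import Data.Sum.Properties using (inj₂-injective)
open import Data.Vec using (Vec; []; _∷_; lookup; replicate)
open import Function using (_∘_; Injective; _↔_; mk↣; Injection)
open import Function.Construct.Composition using (_↔-∘_; _↣-∘_)
open import Function.Construct.Identity using (↔-id)
open import Function.Properties.Inverse using (↔⇒↣)
open import Relation.Binary.PropositionalEquality
open import Relation.Nullary using (¬_; Dec; yes; no; does; contradiction)
open import Relation.Nullary.Decidable using (dec-true; dec-false)
open State

private
  variable
    X : IS
    n p q r s z : ℕ
    σ σ' τ f f' : State
    u : Instr
    vs : List ℕ

reply : Basic → State → Bool
reply a σ = proj₁ (execB a σ)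

exec : Basic → State → State
exec a σ = proj₂ (execB a σ)

branch : Bool → ℕ → ℕ
branch true  p = suc p
branch false p = suc (suc p)

next : Instr → ℕ → State → Maybe (ℕ × State)
next (plain a)      p σ = just (suc p , exec a σ)
next (ptest a)      p σ = just (branch (reply a σ) p , exec a σ)
next (ntest a)      p σ = just (branch (not (reply a σ)) p , exec a σ)
next (jump zero)    p σ = nothing
next (jump (suc l)) p σ = just (p + suc l , σ)
next halt           p σ = nothing

ptest-next : ∀ a {b} → reply a σ ≡ b → next (ptest a) p σ ≡ just (branch b p , exec a σ)
ptest-next _ refl = refl

ntest-next : ∀ a {b} → reply a σ ≡ b → next (ntest a) p σ ≡ just (branch (not b) p , exec a σ)
ntest-next _ refl = refl

data Run (X : IS) : ℕ → State → State → Set where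
  done : lookup-pos X p ≡ just halt → Run X p σ σ
  step : lookup-pos X p ≡ just u → next u p σ ≡ just (q , τ) → Run X q τ f → Run X p σ f

runs⇒run : Runs X p σ f → Run X p σ f
runs⇒run (r-plain e R)                 = step e refl (runs⇒run R)
runs⇒run (r-ptest-1 {a = a} e reply R) = step e (ptest-next a reply) (runs⇒run R)
runs⇒run (r-ptest-0 {a = a} e reply R) = step e (ptest-next a reply) (runs⇒run R)
runs⇒run (r-ntest-0 {a = a} e reply R) = step e (ntest-next a reply) (runs⇒run R)
runs⇒run (r-ntest-1 {a = a} e reply R) = step e (ntest-next a reply) (runs⇒run R)
runs⇒run (r-jump e R)                  = step e refl (runs⇒run R)
runs⇒run (r-halt e)                    = done e

run-done : lookup-pos X p ≡ just halt → Run X p σ f → f ≡ σ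
run-done e (done _)      = refl
run-done e (step e' n _) with refl ← trans (sym e) e' with () ← n

run-next : lookup-pos X p ≡ just u → next u p σ ≡ just (q , τ) → Run X p σ f → Run X q τ f
run-next e n (done e')      with refl ← trans (sym e) e' with () ← n
run-next e n (step e' n' R) with refl ← trans (sym e) e' with refl ← trans (sym n) n' = R

trace : Run X p σ f → List ℕ
trace {p = p} (done _)     = p ∷ []
trace {p = p} (step _ _ R) = p ∷ trace R

n<2+n : ∀ n → n < suc (suc n)
n<2+n n = m<n⇒m<1+n (n<1+n n)

branch-increasing : ∀ b p → p < branch b p
branch-increasing true  p = n<1+n p
branch-increasing false p = n<2+n p

next-increasing : ∀ u → next u p σ ≡ just (q , τ) → p < q
next-increasing (plain _)      refl = n<1+n _
next-increasing (ptest _)      refl = branch-increasing _ _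
next-increasing (ntest _)      refl = branch-increasing _ _
next-increasing (jump (suc _)) refl = m<m+n _ z<s

start-∈-trace : (R : Run X p σ f) → p ∈ trace R
start-∈-trace (done _)     = here refl
start-∈-trace (step _ _ _) = here refl

trace-≥ : (R : Run X p σ f) → z ∈ trace R → p ≤ z
trace-≥ (done _)             (here refl) = ≤-refl
trace-≥ (step _ _ _)         (here refl) = ≤-refl
trace-≥ (step {u = u} _ n R) (there z∈)  = <⇒≤ (<-≤-trans (next-increasing u n) (trace-≥ R z∈))

trace-above : (R : Run X q σ f) → p < q → ∀ {z} → z ∈ trace R → p < z
trace-above R p<q z∈ = <-≤-trans p<q (trace-≥ R z∈)

∉-trace : (R : Run X p σ f) → z < p → z ∉ trace R
∉-trace R z<p z∈ = <⇒≱ z<p (trace-≥ R z∈)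

lookup-pos-< : ∀ X p → lookup-pos X p ≡ just u → p < length X
lookup-pos-< (_ ∷ _) zero    _ = z<s
lookup-pos-< (_ ∷ X) (suc p) e = s≤s (lookup-pos-< X p e)

run-start-< : Run X p σ f → p < length X
run-start-< {X = X} (done e)     = lookup-pos-< X _ e
run-start-< {X = X} (step e _ _) = lookup-pos-< X _ e

trace-< : (R : Run X p σ f) → z ∈ trace R → z < length X
trace-< R@(done _)     (here refl) = run-start-< R
trace-< R@(step _ _ _) (here refl) = run-start-< R
trace-< (step _ _ R)   (there z∈)  = trace-< R z∈

data Effect : Set where
  reads-in : ℕ → Effect
  sets-out : Bool → Effect
  sets-aux halts other : Effect

effectB : Basic → Effect
effectB (in-get i)    = reads-in i
effectB (out-set b)   = sets-out b
effectB (aux-get _)   = other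
effectB (aux-set _ _) = sets-aux

effect : Maybe Instr → Effect
effect (just (plain a)) = effectB a
effect (just (ptest a)) = effectB a
effect (just (ntest a)) = effectB a
effect (just (jump _))  = other
effect (just halt)      = halts
effect nothing          = other

data Assigns : Effect → Set where
  out-assign : ∀ {b} → Assigns (sets-out b)
  aux-assign : Assigns sets-aux

assigns? : ∀ e → Dec (Assigns e)
assigns? (reads-in _) = no λ ()
assigns? (sets-out _) = yes out-assign
assigns? sets-aux     = yes aux-assign
assigns? halts        = no λ ()
assigns? other        = no λ ()

exec-inert : ∀ a → ¬ Assigns (effectB a) → exec a σ ≡ σ
exec-inert (in-get _)    _  = refl
exec-inert (out-set _)   ¬a = contradiction out-assign ¬a
exec-inert (aux-get _)   _  = refl
exec-inert (aux-set _ _) ¬a = contradiction aux-assign ¬a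

next-inert : ∀ u → ¬ Assigns (effect (just u)) → next u p σ ≡ just (q , τ) → τ ≡ σ
next-inert (plain a)      ¬a refl = exec-inert a ¬a
next-inert (ptest a)      ¬a refl = exec-inert a ¬a
next-inert (ntest a)      ¬a refl = exec-inert a ¬a
next-inert (jump (suc _)) _  refl = refl

record Visited (X : IS) (vs : List ℕ) (e : Effect) : Set where
  constructor visit
  field
    place     : ℕ
    visited   : place ∈ vs
    effect-at : effect (lookup-pos X place) ≡ e

visited-∷ : ∀ {e} → Visited X vs e → Visited X (p ∷ vs) e
visited-∷ (visit q q∈ eff) = visit q (there q∈) eff

halt-visited : (R : Run X p σ f) → Visited X (trace R) halts
halt-visited (done e)     = visit _ (here refl) (cong effect e)
halt-visited (step _ _ R) = visited-∷ (halt-visited R)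

exec-keeps-output : ∀ a → outR σ ≡ true → outR (exec a σ) ≡ true ⊎ effectB a ≡ sets-out false
exec-keeps-output (in-get _)      o = inj₁ o
exec-keeps-output (out-set false) _ = inj₂ refl
exec-keeps-output (out-set true)  _ = inj₁ refl
exec-keeps-output (aux-get _)     o = inj₁ o
exec-keeps-output (aux-set _ _)   o = inj₁ o

next-keeps-output : ∀ u → next u p σ ≡ just (q , τ) → outR σ ≡ true →
                    outR τ ≡ true ⊎ effect (just u) ≡ sets-out false
next-keeps-output (plain a)      refl = exec-keeps-output a
next-keeps-output (ptest a)      refl = exec-keeps-output a
next-keeps-output (ntest a)      refl = exec-keeps-output a
next-keeps-output (jump (suc _)) refl = inj₁

reset-visited : (R : Run X p σ f) → outR σ ≡ true → outR f ≡ false →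
                Visited X (trace R) (sets-out false)
reset-visited (done _) o o' = contradiction (trans (sym o') o) λ ()
reset-visited (step {u = u} e n R) o o' with next-keeps-output u n o
... | inj₂ resets = visit _ (here refl) (trans (cong effect e) resets)
... | inj₁ o₁     = visited-∷ (reset-visited R o₁ o')

record AgreeExcept (r : ℕ) (σ σ' : State) : Set where
  constructor agree
  field
    out-≡    : outR σ ≡ outR σ'
    aux-≡    : ∀ i → auxR σ i ≡ auxR σ' i
    in-≡     : ∀ i → i ≢ r → inR σ i ≡ inR σ' i
    in-r-off : inR σ r ≡ false
    in-r-on  : inR σ' r ≡ true
open AgreeExcept

update-cong : ∀ {g h : ℕ → Bool} i b → (∀ k → g k ≡ h k) → ∀ k → update g i b k ≡ update h i b k
update-cong i b g≗h k with i ≟ k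
... | yes _ = refl
... | no _  = g≗h k

exec-agree : AgreeExcept r σ σ' → ∀ a → AgreeExcept r (exec a σ) (exec a σ')
exec-agree ag                        (in-get _)    = ag
exec-agree (agree _ aux ins off on)  (out-set _)   = agree refl aux ins off on
exec-agree ag                        (aux-get _)   = ag
exec-agree (agree out aux ins off on) (aux-set i b) = agree out (update-cong i b aux) ins off on

data ReplyComparison (r : ℕ) (σ σ' : State) : Basic → Set where
  same-reply : ∀ {a} → reply a σ ≡ reply a σ' → ReplyComparison r σ σ' a
  reads-r    : .{{_ : NonZero r}} → ReplyComparison r σ σ' (in-get r)

compare-reply : AgreeExcept r σ σ' → ∀ a → ReplyComparison r σ σ' a
compare-reply {r = r} ag (in-get i) with i ≟ r
... | yes refl = reads-r
... | no i≢r   = same-reply (in-≡ ag i i≢r)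
compare-reply ag (out-set _)   = same-reply refl
compare-reply ag (aux-get i)   = same-reply (aux-≡ ag i)
compare-reply ag (aux-set _ _) = same-reply refl

data Divergence (r p : ℕ) (σ' : State) : Instr → ℕ → State → Set where
  positive : .{{_ : NonZero r}} → next (ptest (in-get r)) p σ' ≡ just (suc p , σ') →
             Divergence r p σ' (ptest (in-get r)) (suc (suc p)) τ
  negative : .{{_ : NonZero r}} → next (ntest (in-get r)) p σ' ≡ just (suc (suc p) , σ') →
             AgreeExcept r τ σ' → Divergence r p σ' (ntest (in-get r)) (suc p) τ

next-agree : AgreeExcept r σ σ' → ∀ u → next u p σ ≡ just (q , τ) →
             (∃ λ τ' → next u p σ' ≡ just (q , τ') × AgreeExcept r τ τ')
             ⊎ Divergence r p σ' u q τ
next-agree ag (plain a)      refl = inj₁ (_ , refl , exec-agree ag a)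
next-agree ag (jump (suc _)) refl = inj₁ (_ , refl , ag)
next-agree ag (ptest a)      refl with compare-reply ag a
... | same-reply eq = inj₁ (_ , ptest-next a (sym eq) , exec-agree ag a)
... | reads-r rewrite in-r-off ag = inj₂ (positive (ptest-next (in-get _) (in-r-on ag)))
next-agree ag (ntest a)      refl with compare-reply ag a
... | same-reply eq = inj₁ (_ , ntest-next a (sym eq) , exec-agree ag a)
... | reads-r rewrite in-r-off ag = inj₂ (negative (ntest-next (in-get _) (in-r-on ag)) ag)

data Witness (X : IS) (vs : List ℕ) (s : ℕ) : Set where
  next-skipped         : suc s ∉ vs → suc s < length X → Witness X vs s
  next-but-one-skipped : suc (suc s) ∉ vs → suc (suc s) < length X → Witness X vs s
  next-assigns         : suc s ∈ vs → Assigns (effect (lookup-pos X (suc s))) → Witness X vs s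

record InputTest (X : IS) (r : ℕ) (vs : List ℕ) : Set where
  field
    read    : Visited X vs (reads-in r)
    witness : Witness X vs (Visited.place read)

∉-∷ : p < z → z ∉ vs → z ∉ p ∷ vs
∉-∷ p<z z∉ (here refl) = <-irrefl refl p<z
∉-∷ p<z z∉ (there z∈)  = z∉ z∈

input-test-∷ : (∀ {z} → z ∈ vs → p < z) → InputTest X r vs → InputTest X r (p ∷ vs)
input-test-∷ {vs = vs} {p = p} {X = X} below t =
  record { read = visited-∷ read ; witness = extend witness }
  where
  open InputTest t
  open Visited read
  p<s : p < place
  p<s = below visited
  extend : Witness X vs place → Witness X (p ∷ vs) place
  extend (next-skipped ∉ <len)         = next-skipped (∉-∷ (<-trans p<s (n<1+n _)) ∉) <len
  extend (next-but-one-skipped ∉ <len) = next-but-one-skipped (∉-∷ (<-trans p<s (n<2+n _)) ∉) <len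
  extend (next-assigns ∈ assigns)      = next-assigns (there ∈) assigns

module _ {X : IS} {r : ℕ} where

  mutual
    input-test-visited : (R : Run X p σ f) → Run X p σ' f' → AgreeExcept r σ σ' →
                         outR f ≡ false → outR f' ≡ true → InputTest X r (trace R)
    input-test-visited (done e) R' ag o o' =
      contradiction (trans (sym o) (trans (out-≡ ag) (trans (cong outR (sym (run-done e R'))) o'))) λ ()
    input-test-visited (step {u = u} e n R) R' ag o o' with next-agree ag u n
    ... | inj₁ (_ , n' , ag') =
      input-test-∷ (trace-above R (next-increasing u n))
        (input-test-visited R (run-next e n' R') ag' o o')
    ... | inj₂ (positive n') = record
      { read    = visit _ (here refl) (cong effect e)
      ; witness = next-skipped (∉-∷ (n<1+n _) (∉-trace R (n<1+n _))) (run-start-< (run-next e n' R'))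
      }
    ... | inj₂ (negative n' ag') = after-negative-test (cong effect e) R (run-next e n' R') ag' o o'

    after-negative-test : effect (lookup-pos X p) ≡ reads-in r → (R : Run X (suc p) σ f) →
                          Run X (suc (suc p)) σ' f' → AgreeExcept r σ σ' →
                          outR f ≡ false → outR f' ≡ true → InputTest X r (p ∷ trace R)
    after-negative-test {p = p} reads (done _) R' _ _ _ = record
      { read    = visit p (here refl) reads
      ; witness = next-but-one-skipped (∉-∷ (n<2+n p) (∉-∷ (n<1+n _) λ ())) (run-start-< R')
      }
    after-negative-test {p = p} reads R₁@(step {u = u} {q = q} e n R) R' ag o o'
      with assigns? (effect (just u))
    ... | yes assigns = record
      { read    = visit p (here refl) reads
      ; witness = next-assigns (there (here refl)) (subst Assigns (sym (cong effect e)) assigns)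
      }
    ... | no inert with refl ← next-inert u inert n with q ≟ suc (suc p)
    ...   | yes refl =
      input-test-∷ (trace-above R₁ (n<1+n p))
        (input-test-∷ (trace-above R (n<1+n (suc p))) (input-test-visited R R' ag o o'))
    ...   | no q≢2+p = record
      { read    = visit p (here refl) reads
      ; witness = next-but-one-skipped (∉-∷ (n<2+n p) (∉-∷ (n<1+n _) (∉-trace R 2+p<q)))
                                       (run-start-< R')
      }
      where 2+p<q = ≤∧≢⇒< (next-increasing u n) (q≢2+p ∘ sym)

_!_ : Vec Bool n → ℕ → Bool
[]       ! _     = false
(b ∷ _)  ! zero  = b
(_ ∷ bs) ! suc i = bs ! i

!-lookup : ∀ (bs : Vec Bool n) i (i<n : i < n) → bs ! i ≡ lookup bs (fromℕ< i<n)
!-lookup (_ ∷ _)  zero    _         = refl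
!-lookup (_ ∷ bs) (suc i) (s≤s i<n) = !-lookup bs i i<n

input : Vec Bool n → ℕ → Bool
input bs zero    = false
input bs (suc i) = bs ! i

input-state : Vec Bool n → State
input-state bs = st (input bs) false (λ _ → false)

unit : Fin n → Vec Bool n
unit {suc n} 0F  = true ∷ replicate n false
unit (Fin.suc j) = false ∷ unit j

replicate-! : ∀ n i → replicate n false ! i ≡ false
replicate-! zero    _       = refl
replicate-! (suc n) zero    = refl
replicate-! (suc n) (suc i) = replicate-! n i

unit-!-self : (j : Fin n) → unit j ! toℕ j ≡ true
unit-!-self 0F          = refl
unit-!-self (Fin.suc j) = unit-!-self j

unit-!-other : (j : Fin n) → ∀ i → i ≢ toℕ j → unit j ! i ≡ false
unit-!-other 0F          zero    i≢j = contradiction refl i≢j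
unit-!-other {suc n} 0F  (suc i) _   = replicate-! n i
unit-!-other (Fin.suc j) zero    _   = refl
unit-!-other (Fin.suc j) (suc i) i≢j = unit-!-other j i (i≢j ∘ cong suc)

tstnz-replicate : ∀ n → tstnz n (replicate n false) ≡ false
tstnz-replicate zero    = refl
tstnz-replicate (suc n) = tstnz-replicate n

tstnz-unit : (j : Fin n) → tstnz n (unit j) ≡ true
tstnz-unit 0F          = refl
tstnz-unit (Fin.suc j) = tstnz-unit j

input-states-agree : (j : Fin n) →
  AgreeExcept (suc (toℕ j)) (input-state (replicate n false)) (input-state (unit j))
input-states-agree {n} j =
  agree refl (λ _ → refl) inputs-≡ (replicate-! n (toℕ j)) (unit-!-self j)
  where
  inputs-≡ : ∀ i → i ≢ suc (toℕ j) → input (replicate n false) i ≡ input (unit j) i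
  inputs-≡ zero    _   = refl
  inputs-≡ (suc i) i≢j = trans (replicate-! n i) (sym (unit-!-other j i (i≢j ∘ cong suc)))

record Landmarks (X : IS) (n : ℕ) (vs : List ℕ) : Set where
  field
    bounded    : ∀ {q} → q ∈ vs → q < length X
    start      : 0 ∈ vs
    start-sets : effect (lookup-pos X 0) ≡ sets-out true
    halts-at   : Visited X vs halts
    resets-at  : Visited X vs (sets-out false)
    tests      : (j : Fin n) → InputTest X (suc (toℕ j)) vs

Token : ℕ → Set
Token n = Fin 5 ⊎ (Fin 3 × Fin n)

Description : Set
Description = Fin 5 ⊎ (Fin 3 × ℕ)

describe : Token n → Description
describe (inj₁ i)       = inj₁ i
describe (inj₂ (k , j)) = inj₂ (k , toℕ j)

describe-injective : Injective _≡_ _≡_ (describe {n})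
describe-injective {x = inj₁ _}       {y = inj₁ _}         refl = refl
describe-injective {x = inj₂ (k , _)} {y = inj₂ (_ , _)} eq
  with refl , j≡j' ← ,-injective (inj₂-injective eq) = cong (λ j → inj₂ (k , j)) (toℕ-injective j≡j')

tokens : Fin (5 + 3 * n) ↔ Token n
tokens = (↔-id _ ⊎-↔ *↔×) ↔-∘ +↔⊎

reads-index : Effect → ℕ
reads-index (reads-in (suc j)) = j
reads-index _                  = 0

module _ {X : IS} {n : ℕ} {vs : List ℕ} (lm : Landmarks X n vs) where
  open Landmarks lm

  test-position : Fin n → ℕ
  test-position j = Visited.place (InputTest.read (tests j))

  index-read-at : ℕ → ℕ
  index-read-at q = reads-index (effect (lookup-pos X q))

  witness-slot : Witness X vs s → ℕ × Fin 2
  witness-slot {s = s} (next-skipped _ _)         = suc s , 0F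
  witness-slot {s = s} (next-but-one-skipped _ _) = suc (suc s) , 1F
  witness-slot {s = s} (next-assigns _ _)         = suc s , 1F

  slot : Token n → ℕ × Fin 2
  slot (inj₁ 0F)       = 0 , 0F
  slot (inj₁ 1F)       = 0 , 1F
  slot (inj₁ 2F)       = Visited.place halts-at , 0F
  slot (inj₁ 3F)       = Visited.place halts-at , 1F
  slot (inj₁ 4F)       = Visited.place resets-at , 0F
  slot (inj₂ (0F , j)) = test-position j , 0F
  slot (inj₂ (1F , j)) = test-position j , 1F
  slot (inj₂ (2F , j)) = witness-slot (InputTest.witness (tests j))

  decode-visited : ℕ → Fin 2 → Effect → Description
  decode-visited _       0F halts              = inj₁ 2F
  decode-visited _       1F halts              = inj₁ 3F
  decode-visited _       b  (reads-in (suc j)) = inj₂ (inject₁ b , j)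
  decode-visited _       0F (sets-out true)    = inj₁ 0F
  decode-visited _       0F (sets-out false)   = inj₁ 4F
  decode-visited zero    1F _                  = inj₁ 1F
  decode-visited (suc q) 1F _                  = inj₂ (2F , index-read-at q)
  decode-visited _       _  _                  = inj₁ 0F  -- not the slot of any token

  decode-skipped : ℕ → Fin 2 → Description
  decode-skipped (suc q)       0F = inj₂ (2F , index-read-at q)
  decode-skipped (suc (suc q)) 1F = inj₂ (2F , index-read-at q)
  decode-skipped _             _  = inj₁ 0F  -- not the slot of any token

  -- A half-slot determines its token: visited positions are told apart by their effect
  -- (and the start by being position 0), unvisited ones only hold traces of tests, and
  -- the index of the test is read off the instruction one or two positions earlier.
  decode : ℕ × Fin 2 → Description
  decode (q , b) =
    if does (q ∈? vs) then decode-visited q b (effect (lookup-pos X q)) else decode-skipped q b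

  decode-visit : ∀ {e} (v : Visited X vs e) b →
                 decode (Visited.place v , b) ≡ decode-visited (Visited.place v) b e
  decode-visit (visit q q∈ refl) b rewrite dec-true (q ∈? vs) q∈ = refl

  decode-skipped-at : q ∉ vs → ∀ b → decode (q , b) ≡ decode-skipped q b
  decode-skipped-at {q = q} q∉ b rewrite dec-false (q ∈? vs) q∉ = refl

  decode-visited-assigns : ∀ {e} → Assigns e → decode-visited (suc q) 1F e ≡ inj₂ (2F , index-read-at q)
  decode-visited-assigns out-assign = refl
  decode-visited-assigns aux-assign = refl

  decode-slot : ∀ t → decode (slot t) ≡ describe t
  decode-slot (inj₁ 0F)       = decode-visit (visit 0 start start-sets) 0F
  decode-slot (inj₁ 1F)       = decode-visit (visit 0 start start-sets) 1F
  decode-slot (inj₁ 2F)       = decode-visit halts-at 0F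
  decode-slot (inj₁ 3F)       = decode-visit halts-at 1F
  decode-slot (inj₁ 4F)       = decode-visit resets-at 0F
  decode-slot (inj₂ (0F , j)) = decode-visit (InputTest.read (tests j)) 0F
  decode-slot (inj₂ (1F , j)) = decode-visit (InputTest.read (tests j)) 1F
  decode-slot (inj₂ (2F , j)) = decode-witness (InputTest.witness (tests j))
    where
    read-j : inj₂ (2F , index-read-at (test-position j)) ≡ describe (inj₂ (2F , j))
    read-j = cong (λ e → inj₂ (2F , reads-index e)) (Visited.effect-at (InputTest.read (tests j)))
    decode-witness : (w : Witness X vs (test-position j)) → decode (witness-slot w) ≡ describe (inj₂ (2F , j))
    decode-witness (next-skipped q∉ _)         = trans (decode-skipped-at q∉ 0F) read-j
    decode-witness (next-but-one-skipped q∉ _) = trans (decode-skipped-at q∉ 1F) read-j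
    decode-witness (next-assigns q∈ assigns)   =
      trans (decode-visit (visit _ q∈ refl) 1F) (trans (decode-visited-assigns assigns) read-j)

  slot-injective : Injective _≡_ _≡_ slot
  slot-injective {t} {t'} eq =
    describe-injective (trans (sym (decode-slot t)) (trans (cong decode eq) (decode-slot t')))

  slot-bounded : ∀ t → proj₁ (slot t) < length X
  slot-bounded (inj₁ 0F)       = bounded start
  slot-bounded (inj₁ 1F)       = bounded start
  slot-bounded (inj₁ 2F)       = bounded (Visited.visited halts-at)
  slot-bounded (inj₁ 3F)       = bounded (Visited.visited halts-at)
  slot-bounded (inj₁ 4F)       = bounded (Visited.visited resets-at)
  slot-bounded (inj₂ (0F , j)) = bounded (Visited.visited (InputTest.read (tests j)))
  slot-bounded (inj₂ (1F , j)) = bounded (Visited.visited (InputTest.read (tests j)))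
  slot-bounded (inj₂ (2F , j)) = witness-bounded (InputTest.witness (tests j))
    where
    witness-bounded : (w : Witness X vs s) → proj₁ (witness-slot w) < length X
    witness-bounded (next-skipped _ <len)         = <len
    witness-bounded (next-but-one-skipped _ <len) = <len
    witness-bounded (next-assigns q∈ _)           = bounded q∈

  slot-index : Token n → Fin (length X * 2)
  slot-index t = combine (fromℕ< (slot-bounded t)) (proj₂ (slot t))

  slot-index-injective : Injective _≡_ _≡_ slot-index
  slot-index-injective {t} {t'} eq with places , halves ← combine-injective _ _ _ _ eq =
    slot-injective (×-≡,≡→≡ (same-place , halves))
    where
    same-place : proj₁ (slot t) ≡ proj₁ (slot t')
    same-place = trans (sym (toℕ-fromℕ< (slot-bounded t)))
                       (trans (cong toℕ places) (toℕ-fromℕ< (slot-bounded t')))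

  5+3n≤length*2 : 5 + 3 * n ≤ length X * 2
  5+3n≤length*2 = injective⇒≤ (Injection.injective (mk↣ slot-index-injective ↣-∘ ↔⇒↣ tokens))

L*2≤3n+3 : ∀ n → L n * 2 ≤ 3 * n + 3
L*2≤3n+3 n with even n
... | true  = begin
  (3 * n / 2 + 1) * 2 ≡⟨ *-distribʳ-+ 2 (3 * n / 2) 1 ⟩
  3 * n / 2 * 2 + 2   ≤⟨ +-mono-≤ (m/n*n≤m (3 * n) 2) (n≤1+n 2) ⟩
  3 * n + 3           ∎
  where open ≤-Reasoning
... | false = begin
  3 * (n + 1) / 2 * 2 ≤⟨ m/n*n≤m (3 * (n + 1)) 2 ⟩
  3 * (n + 1)         ≡⟨ *-distribˡ-+ 3 n 1 ⟩
  3 * n + 3           ∎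
  where open ≤-Reasoning

5+3n≤m*2⇒L<m : ∀ n m → 5 + 3 * n ≤ m * 2 → L n < m
5+3n≤m*2⇒L<m n m counted = ≰⇒> λ m≤Ln → <-irrefl refl (begin-strict
  5 + 3 * n ≤⟨ counted ⟩
  m * 2     ≤⟨ *-monoˡ-≤ 2 m≤Ln ⟩
  L n * 2   ≤⟨ L*2≤3n+3 n ⟩
  3 * n + 3 ≡⟨ +-comm (3 * n) 3 ⟩
  3 + 3 * n <⟨ +-monoˡ-< (3 * n) (n<2+n 3) ⟩
  5 + 3 * n ∎)
  where open ≤-Reasoning

module _ {Y : IS} where

  start-sets-output : X ≡ plain (out-set true) ∷ Y ⊎ X ≡ ptest (out-set true) ∷ Y →
                      effect (lookup-pos X 0) ≡ sets-out true
  start-sets-output (inj₁ refl) = refl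
  start-sets-output (inj₂ refl) = refl

  reset-after-start : X ≡ plain (out-set true) ∷ Y ⊎ X ≡ ptest (out-set true) ∷ Y →
                      (R : Run X 0 σ f) → outR f ≡ false → Visited X (trace R) (sets-out false)
  reset-after-start (inj₁ refl) (step refl refl R) o = visited-∷ (reset-visited R refl o)
  reset-after-start (inj₂ refl) (step refl refl R) o = visited-∷ (reset-visited R refl o)
  reset-after-start (inj₁ refl) (done ())
  reset-after-start (inj₂ refl) (done ())

corollary2 : ∀ (n : ℕ) → 1 ≤ n → ∀ (X Y : IS) →
    (X ≡ plain (out-set true) ∷ Y ⊎ X ≡ ptest (out-set true) ∷ Y) →
    Computes n (tstnz n) X → L n < length X
corollary2 n _ X Y starts (_ , computes)
  with computes zeros (input-state zeros) (!-lookup zeros) refl (λ _ _ _ → refl)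
  where zeros = replicate n false
... | _ , R₀ , out₀ = 5+3n≤m*2⇒L<m n (length X) (5+3n≤length*2 landmarks)
  where
  zero-run = runs⇒run R₀
  rejects  = trans out₀ (tstnz-replicate n)

  test : (j : Fin n) → InputTest X (suc (toℕ j)) (trace zero-run)
  test j with computes (unit j) (input-state (unit j)) (!-lookup (unit j)) refl (λ _ _ _ → refl)
  ... | _ , Rⱼ , outⱼ =
    input-test-visited zero-run (runs⇒run Rⱼ) (input-states-agree j) rejects (trans outⱼ (tstnz-unit j))

  landmarks : Landmarks X n (trace zero-run)
  landmarks = record
    { bounded    = trace-< zero-run
    ; start      = start-∈-trace zero-run
    ; start-sets = start-sets-output starts
    ; halts-at   = halt-visited zero-run
    ; resets-at  = reset-after-start starts zero-run rejects
    ; tests      = test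
    }
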